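{- Let $F$ be a gene tree forest and let $H(F)=(V,E)$ be the edge-labeled graph associated to $F$. Then for every bipartition $B=(V_1,V_2)$ of $L(F)$, the number $d_1(F,B)$ of duplications of $F$ preceding the first speciation with respect to $B$ equals the label-size of the edge-cut $E(B)$ of $H(F)$ induced by $B$.
   Context: A gene tree on a set of genomes $\mathcal{G}=\{1,\dots,k\}$ is a rooted binary tree (every internal vertex has exactly two children, denoted $x_l$ and $x_r$) whose leaves are labeled by elements of $\mathcal{G}$ (labels may repeat). A gene tree forest $F$ is a finite set of gene trees. For a vertex $x$, $L(x)$ is the set of labels of the leaves of the subtree rooted at $x$; $L(F)$ is the set of all leaf labels of $F$. A bipartition $B=(V_1,V_2)$ of a set $V$ is a pair of disjoint nonempty sets with $V_1\cup V_2=V$; it is viewed as a species tree with root $v$ having two children $v_1,v_2$, where the leaves below $v_i$ are exactly the elements of $V_i$. The LCA mapping $M$ sends a vertex $x$ of $F$ to the unique vertex $w$ of this species tree such that $L(x)\subseteq L(w)$ and either $w$ is a leaf or $L(x)$ is not contained in the leaf set of any child of $w$. An internal vertex $x$ of $F$ is a duplication preceding the first speciation with respect to $B$ if $M(x)=v$ and ($M(x_l)=v$ or $M(x_r)=v$); $d_1(F,B)$ is the number of such vertices. Label the internal vertices of $F$ injectively by $1,\dots,m$. The graph $H(F)$ has vertex set $L(F)$, and for each internal vertex $x$ with label $a$ and each pair of distinct $s,t$ with $\{s,t\}\subseteq L(x_l)$ or $\{s,t\}\subseteq L(x_r)$, there is an edge between $s$ and $t$ labeled $a$ (so parallel edges with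 distinct labels may occur). For a bipartition $B=(V_1,V_2)$ of the vertex set, $E(B)$ is the set of edges with one endpoint in $V_1$ and the other in $V_2$, and its label-size is the number of distinct labels of edges in $E(B)$. -}

module Defs where

open import Data.Nat using (ℕ; zero; suc; _+_)
open import Data.Fin using (Fin; _≟_)
open import Data.Bool using (Bool; true; false; _∧_; _∨_; not; if_then_else_)
open import Data.List using (List; []; _∷_; _++_; length; filter; map; concatMap; any; deduplicate)
open import Data.Product using (_×_; _,_; proj₁; proj₂)
open import Relation.Nullary.Decidable using (⌊_⌋; ¬?)
import Data.Nat as ℕ

-- Gene trees on the genome set {0,…,k-1} (= Fin k): rooted binary trees
-- whose leaves carry genome labels (labels may repeat).
data GeneTree (k : ℕ) : Set where
  leaf : Fin k → GeneTree k
  node : GeneTree k → GeneTree k → GeneTree k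

Forest : ℕ → Set
Forest k = List (GeneTree k)

module _ {k : ℕ} where

  L : GeneTree k → List (Fin k)
  L (leaf g)   = g ∷ []
  L (node l r) = L l ++ L r

  LF : Forest k → List (Fin k)
  LF = concatMap L

  -- A bipartition B = (V₁ , V₂) of L(F) is given by a side function
  -- (side g ≡ true  ↔  g ∈ V₁, side g ≡ false ↔ g ∈ V₂, for g ∈ L(F)),
  -- together with nonemptiness of both sides (see IsBipartition).
  Side : Set
  Side = Fin k → Bool

  -- LCA mapping to the species tree of B: M(x) = v (the root) iff
  -- L(x) ⊆ L(v) (always) and L(x) is contained neither in V₁ = L(v₁)
  -- nor in V₂ = L(v₂), i.e. L(x) meets both V₁ and V₂.
  allB : (Fin k → Bool) → List (Fin k) → Bool
  allB p []       = true
  allB p (x ∷ xs) = p x ∧ allB p xs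

  MapsToRoot : Side → GeneTree k → Bool
  MapsToRoot B x = not (allB B (L x)) ∧ not (allB (λ g → not (B g)) (L x))

  -- number of internal vertices x of a tree that are duplications preceding
  -- the first speciation: M(x) = v and (M(x_l) = v or M(x_r) = v)
  d1Tree : Side → GeneTree k → ℕ
  d1Tree B (leaf _)   = 0
  d1Tree B (node l r) =
    (if MapsToRoot B (node l r) ∧ (MapsToRoot B l ∨ MapsToRoot B r) then 1 else 0)
    + d1Tree B l + d1Tree B r

  d1 : Forest k → Side → ℕ
  d1 [] B = 0
  d1 (t ∷ F) B = d1Tree B t + d1 F B

  -- Edges of H(F): (label , s , t).
  Edge : Set
  Edge = ℕ × Fin k × Fin k

  distinctPairs : List (Fin k) → List (Fin k × Fin k)
  distinctPairs xs = concatMap (λ s → map (λ t → (s , t)) (filter (λ t → ¬? (s ≟ t)) xs)) xs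

  vertexEdges : ℕ → GeneTree k → GeneTree k → List Edge
  vertexEdges a l r = map (λ p → (a , proj₁ p , proj₂ p)) (distinctPairs (L l) ++ distinctPairs (L r))

  -- injective labelling of internal vertices by consecutive numbers
  -- (preorder, starting from the counter n); returns next free counter and edges
  treeEdges : ℕ → GeneTree k → ℕ × List Edge
  treeEdges n (leaf _)   = (n , [])
  treeEdges n (node l r) =
    let el = treeEdges (suc n) l
        er = treeEdges (proj₁ el) r
    in (proj₁ er , vertexEdges n l r ++ proj₂ el ++ proj₂ er)

  forestEdges : ℕ → Forest k → ℕ × List Edge
  forestEdges n []      = (n , [])
  forestEdges n (t ∷ F) =
    let et = treeEdges n t
        eF = forestEdges (proj₁ et) F
    in (proj₁ eF , proj₂ et ++ proj₂ eF)

  -- edge multiset of H(F) (vertex set is L(F)); internal vertices labelled 1,…,m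
  HEdges : Forest k → List Edge
  HEdges F = proj₂ (forestEdges 1 F)

  crosses : Side → Edge → Bool
  crosses B (a , s , t) = not (B s ∧ B t) ∧ (B s ∨ B t)

  cut : Forest k → Side → List Edge
  cut F B = filter (λ e → Data.Bool._≟_ (crosses B e) true) (HEdges F)

  labelSize : List Edge → ℕ
  labelSize es = length (deduplicate ℕ._≟_ (map proj₁ es))

open import Data.List.Membership.Propositional using (_∈_)
open import Relation.Binary.PropositionalEquality using (_≡_)
open import Data.Product using (Σ; ∃)

IsBipartition : {k : ℕ} → Forest k → Side {k} → Set
IsBipartition F B = (Σ _ λ s → s ∈ LF F × B s ≡ true) × (Σ _ λ t → t ∈ LF F × B t ≡ false)

-- An internal vertex x with label a contributes to H(F) only edges labelled a,
-- and one of them crosses B exactly when a child of x has leaves on both sides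
-- of B, i.e. when M(x_l) = v or M(x_r) = v; in that case also M(x) = v.  So the
-- label a occurs in E(B) iff x is a duplication preceding the first speciation.
-- The labels of distinct internal vertices are distinct, hence the label-size
-- of E(B) counts these vertices.
module Submission where

open import Defs
open import Data.Nat using (ℕ; suc; _+_; _≤_; _<_; _≟_)
open import Data.Bool using (Bool; true; false; _∧_; _∨_; not; if_then_else_)
import Data.Bool as Bool
open import Data.Bool.Properties using (∧-zeroʳ; not-injective)
open import Data.Nat.Properties using (≤-refl; ≤-trans; <-≤-trans; <-irrefl; n≤1+n; +-assoc)
open import Data.Fin using (Fin)
import Data.Fin as Fin
open import Data.List using (List; []; _∷_; _++_; length; filter; map; deduplicate)
open import Data.List.Properties using (filter-++; map-++; filter-none; length-++)
open import Data.List.Relation.Unary.All as All using (All; []; _∷_)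
import Data.List.Relation.Unary.All.Properties as All
open import Data.List.Relation.Unary.Any as Any using (here; there)
open import Data.List.Membership.Propositional using (_∈_)
open import Data.List.Membership.Propositional.Properties
  using (∈-filter⁺; ∈-filter⁻; ∈-map⁺; ∈-map⁻; ∈-++⁺ˡ; ∈-++⁺ʳ; ∈-++⁻; ∈-concatMap⁺; ∈-concatMap⁻)
open import Data.List.Relation.Binary.Disjoint.Propositional using (Disjoint)
open import Data.List.Relation.Binary.Permutation.Propositional.Properties using (↭-length)
open import Data.List.Relation.Binary.Permutation.Propositional.Properties.WithK using (dedup-++-↭)
open import Data.Product using (_×_; _,_; proj₁; proj₂; ∃; ∃₂)
open import Data.Sum using (inj₁; inj₂)
open import Function using (_∘_)
open import Relation.Nullary using (¬_)
open import Relation.Nullary.Decidable using (¬?)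
open import Relation.Binary.PropositionalEquality using (_≡_; _≢_; refl; sym; trans; cong; cong₂; module ≡-Reasoning)

#distinct : List ℕ → ℕ
#distinct xs = length (deduplicate _≟_ xs)

#distinct-++ : ∀ {xs ys} → Disjoint xs ys → #distinct (xs ++ ys) ≡ #distinct xs + #distinct ys
#distinct-++ {xs} xs#ys = trans (↭-length (dedup-++-↭ _≟_ xs#ys)) (length-++ (deduplicate _≟_ xs))

#distinct-constant : ∀ {n x xs} → x ∈ xs → All (_≡ n) xs → #distinct xs ≡ 1
#distinct-constant {xs = y ∷ ys} _ (y≡n ∷ ys≡n) =
  cong (suc ∘ length)
    (filter-none _ (All.map (λ z≡n y≢z → y≢z (trans y≡n (sym z≡n))) (All.deduplicate⁺ _≟_ ys≡n)))

<-≤-disjoint : ∀ {m xs ys} → All (_< m) xs → All (m ≤_) ys → Disjoint xs ys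
<-≤-disjoint xs<m m≤ys (x∈xs , x∈ys) = <-irrefl refl (<-≤-trans (All.lookup xs<m x∈xs) (All.lookup m≤ys x∈ys))

module _ {k : ℕ} where

  allB-true : ∀ (p : Fin k → Bool) {xs x} → allB p xs ≡ true → x ∈ xs → p x ≡ true
  allB-true p {y ∷ xs} allp (here refl) with p y
  ... | true = refl
  allB-true p {y ∷ xs} allp (there x∈xs) with p y
  ... | true = allB-true p allp x∈xs

  allB-false : ∀ (p : Fin k → Bool) xs → allB p xs ≡ false → ∃ λ x → x ∈ xs × p x ≡ false
  allB-false p (x ∷ xs) allp with p x in px
  ... | false = x , here refl , px
  ... | true with allB-false p xs allp
  ... | y , y∈xs , py = y , there y∈xs , py

  pairsFrom : Fin k → List (Fin k) → List (Fin k × Fin k)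
  pairsFrom s ys = map (s ,_) (filter (λ t → ¬? (s Fin.≟ t)) ys)

  ∈-pairsFrom⁻ : ∀ {s t x ys} → (s , t) ∈ pairsFrom x ys → s ≡ x × t ∈ ys
  ∈-pairsFrom⁻ {x = x} st∈ with ∈-map⁻ (x ,_) st∈
  ... | _ , t∈ , refl = refl , proj₁ (∈-filter⁻ (λ t → ¬? (x Fin.≟ t)) t∈)

  ∈-distinctPairs⁺ : ∀ {xs s t} → s ∈ xs → t ∈ xs → s ≢ t → (s , t) ∈ distinctPairs xs
  ∈-distinctPairs⁺ {xs} s∈xs t∈xs s≢t =
    ∈-concatMap⁺ (λ x → pairsFrom x xs)
      (Any.map (λ { refl → ∈-map⁺ _ (∈-filter⁺ (λ t → ¬? (_ Fin.≟ t)) t∈xs s≢t) }) s∈xs)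

  ∈-distinctPairs⁻ : ∀ {xs s t} → (s , t) ∈ distinctPairs xs → s ∈ xs × t ∈ xs
  ∈-distinctPairs⁻ {xs} st∈ =
    Any.map (λ st∈ → proj₁ (∈-pairsFrom⁻ {ys = xs} st∈)) st∈ys ,
    proj₂ (∈-pairsFrom⁻ (proj₂ (Any.satisfied st∈ys)))
    where st∈ys = ∈-concatMap⁻ (λ x → pairsFrom x xs) st∈

  treeNext : ℕ → GeneTree k → ℕ
  treeNext n t = proj₁ (treeEdges n t)

  treeEdgeList : ℕ → GeneTree k → List (Edge {k})
  treeEdgeList n t = proj₂ (treeEdges n t)

  forestEdgeList : ℕ → Forest k → List (Edge {k})
  forestEdgeList n F = proj₂ (forestEdges n F)

  vertexEdges-labels : ∀ a (l r : GeneTree k) → All ((_≡ a) ∘ proj₁) (vertexEdges a l r)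
  vertexEdges-labels a l r = All.map⁺ (All.tabulate (λ _ → refl))

  treeEdges-labels : ∀ n t →
    n ≤ treeNext n t × All (λ e → n ≤ proj₁ e × proj₁ e < treeNext n t) (treeEdgeList n t)
  treeEdges-labels n (leaf _)   = ≤-refl , []
  treeEdges-labels n (node l r)
    with treeEdges-labels (suc n) l | treeEdges-labels (treeNext (suc n) l) r
  ... | n<m , inL | m≤m′ , inR =
    n≤m′ , All.++⁺ (All.map (λ { refl → ≤-refl , <-≤-trans n<m m≤m′ }) (vertexEdges-labels n l r))
             (All.++⁺ (All.map (λ (n<a , a<m) → ≤-trans (n≤1+n n) n<a , <-≤-trans a<m m≤m′) inL)
                      (All.map (λ (m≤a , a<m′) → ≤-trans n≤m m≤a , a<m′) inR))
    where
      n≤m : n ≤ treeNext (suc n) l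
      n≤m = ≤-trans (n≤1+n n) n<m
      n≤m′ : n ≤ treeNext n (node l r)
      n≤m′ = ≤-trans n≤m m≤m′

  forestEdges-labels : ∀ n F → All ((n ≤_) ∘ proj₁) (forestEdgeList n F)
  forestEdges-labels n []      = []
  forestEdges-labels n (t ∷ F) with treeEdges-labels n t
  ... | n≤m , inT = All.++⁺ (All.map proj₁ inT) (All.map (≤-trans n≤m) (forestEdges-labels (treeNext n t) F))

  module _ (B : Side {k}) where

    -- MapsToRoot B x is definitionally Mixed (L x).
    Mixed : List (Fin k) → Bool
    Mixed xs = not (allB B xs) ∧ not (allB (not ∘ B) xs)

    mixed⇒both-sides : ∀ xs → Mixed xs ≡ true →
      ∃₂ λ s t → s ∈ xs × t ∈ xs × B s ≡ false × B t ≡ true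
    mixed⇒both-sides xs mixed with allB B xs in allV₁ | allB (not ∘ B) xs in allV₂
    mixed⇒both-sides xs refl | false | false with allB-false B xs allV₁ | allB-false (not ∘ B) xs allV₂
    ... | s , s∈xs , Bs | t , t∈xs , ¬Bt = s , t , s∈xs , t∈xs , Bs , not-injective ¬Bt

    both-sides⇒mixed : ∀ {xs s t} → s ∈ xs → t ∈ xs → B s ≡ false → B t ≡ true → Mixed xs ≡ true
    both-sides⇒mixed {xs} s∈xs t∈xs Bs Bt with allB B xs in allV₁ | allB (not ∘ B) xs in allV₂
    ... | false | false = refl
    ... | true  | _     with () ← trans (sym Bs) (allB-true B allV₁ s∈xs)
    ... | false | true  with () ← trans (sym (cong not Bt)) (allB-true (not ∘ B) allV₂ t∈xs)

    unmixed⇒constant : ∀ xs {s t} → Mixed xs ≡ false → s ∈ xs → t ∈ xs → B s ≡ B t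
    unmixed⇒constant xs unmixed s∈xs t∈xs with allB B xs in allV₁ | allB (not ∘ B) xs in allV₂
    ... | true  | _    = trans (allB-true B allV₁ s∈xs) (sym (allB-true B allV₁ t∈xs))
    ... | false | true =
      not-injective (trans (allB-true (not ∘ B) allV₂ s∈xs) (sym (allB-true (not ∘ B) allV₂ t∈xs)))
    unmixed⇒constant xs () _ _ | false | false

    mixed-++ˡ : ∀ xs ys → Mixed xs ≡ true → Mixed (xs ++ ys) ≡ true
    mixed-++ˡ xs ys mixed with mixed⇒both-sides xs mixed
    ... | _ , _ , s∈xs , t∈xs , Bs , Bt = both-sides⇒mixed (∈-++⁺ˡ s∈xs) (∈-++⁺ˡ t∈xs) Bs Bt

    mixed-++ʳ : ∀ xs ys → Mixed ys ≡ true → Mixed (xs ++ ys) ≡ true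
    mixed-++ʳ xs ys mixed with mixed⇒both-sides ys mixed
    ... | _ , _ , s∈ys , t∈ys , Bs , Bt = both-sides⇒mixed (∈-++⁺ʳ xs s∈ys) (∈-++⁺ʳ xs t∈ys) Bs Bt

    mixed⇒splitPair : ∀ xs → Mixed xs ≡ true →
      ∃₂ λ s t → (s , t) ∈ distinctPairs xs × B s ≡ false × B t ≡ true
    mixed⇒splitPair xs mixed with mixed⇒both-sides xs mixed
    ... | s , t , s∈xs , t∈xs , Bs , Bt =
      s , t , ∈-distinctPairs⁺ s∈xs t∈xs (λ { refl → false≢true (trans (sym Bs) Bt) }) , Bs , Bt
      where
        false≢true : false ≢ true
        false≢true ()

    crosses-split : ∀ a {s t} → B s ≡ false → B t ≡ true → crosses B (a , s , t) ≡ true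
    crosses-split a Bs Bt rewrite Bs | Bt = refl

    crosses-same : ∀ a {s t} → B s ≡ B t → crosses B (a , s , t) ≡ false
    crosses-same a {t = t} Bs≡Bt rewrite Bs≡Bt with B t
    ... | true  = refl
    ... | false = refl

    -- labelSize (cut F B) is definitionally #distinct (cutLabels (HEdges F)).
    cutLabels : List (Edge {k}) → List ℕ
    cutLabels es = map proj₁ (filter (λ e → crosses B e Bool.≟ true) es)

    cutLabels-++ : ∀ es fs → cutLabels (es ++ fs) ≡ cutLabels es ++ cutLabels fs
    cutLabels-++ es fs =
      trans (cong (map proj₁) (filter-++ _ es fs)) (map-++ proj₁ (filter _ es) (filter _ fs))

    cutLabels-All : ∀ {P : ℕ → Set} {es} → All (P ∘ proj₁) es → All P (cutLabels es)
    cutLabels-All = All.map⁺ ∘ All.filter⁺ _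

    splitPair⇒counted : ∀ a l r {s t} → (s , t) ∈ distinctPairs (L l) ++ distinctPairs (L r) →
      B s ≡ false → B t ≡ true → #distinct (cutLabels (vertexEdges a l r)) ≡ 1
    splitPair⇒counted a l r st∈ Bs Bt =
      #distinct-constant
        (∈-map⁺ proj₁ (∈-filter⁺ (λ e → crosses B e Bool.≟ true) (∈-map⁺ (a ,_) st∈) (crosses-split a Bs Bt)))
        (cutLabels-All (vertexEdges-labels a l r))

    unmixed⇒uncounted : ∀ a l r → Mixed (L l) ≡ false → Mixed (L r) ≡ false →
      cutLabels (vertexEdges a l r) ≡ []
    unmixed⇒uncounted a l r unmixedˡ unmixedʳ =
      cong (map proj₁) (filter-none _ (All.map⁺ (All.tabulate uncrossed)))
      where
        uncrossed : ∀ {st} → st ∈ distinctPairs (L l) ++ distinctPairs (L r) →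
          ¬ (crosses B (a , proj₁ st , proj₂ st) ≡ true)
        uncrossed {s , t} st∈ crossed with ∈-++⁻ (distinctPairs (L l)) st∈
        ... | inj₁ st∈l with s∈ , t∈ ← ∈-distinctPairs⁻ st∈l
            with () ← trans (sym crossed) (crosses-same a (unmixed⇒constant (L l) unmixedˡ s∈ t∈))
        ... | inj₂ st∈r with s∈ , t∈ ← ∈-distinctPairs⁻ st∈r
            with () ← trans (sym crossed) (crosses-same a (unmixed⇒constant (L r) unmixedʳ s∈ t∈))

    d1Vertex : GeneTree k → GeneTree k → ℕ
    d1Vertex l r = if MapsToRoot B (node l r) ∧ (MapsToRoot B l ∨ MapsToRoot B r) then 1 else 0

    #distinct-cutLabels-vertexEdges : ∀ a l r → #distinct (cutLabels (vertexEdges a l r)) ≡ d1Vertex l r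
    #distinct-cutLabels-vertexEdges a l r with Mixed (L l) in mixedˡ | Mixed (L r) in mixedʳ
    ... | true | _
      rewrite mixed-++ˡ (L l) (L r) mixedˡ
      with s , t , st∈ , Bs , Bt ← mixed⇒splitPair (L l) mixedˡ
      = splitPair⇒counted a l r (∈-++⁺ˡ st∈) Bs Bt
    ... | false | true
      rewrite mixed-++ʳ (L l) (L r) mixedʳ
      with s , t , st∈ , Bs , Bt ← mixed⇒splitPair (L r) mixedʳ
      = splitPair⇒counted a l r (∈-++⁺ʳ (distinctPairs (L l)) st∈) Bs Bt
    ... | false | false
      rewrite ∧-zeroʳ (MapsToRoot B (node l r)) | unmixed⇒uncounted a l r mixedˡ mixedʳ
      = refl

    #distinct-cutLabels-tree : ∀ n t → #distinct (cutLabels (treeEdgeList n t)) ≡ d1Tree B t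
    #distinct-cutLabels-tree n (leaf _)   = refl
    #distinct-cutLabels-tree n (node l r)
      with treeEdges-labels (suc n) l | treeEdges-labels (treeNext (suc n) l) r
    ... | n<m , inL | m≤m′ , inR = begin
      #distinct (cutLabels (V ++ EL ++ ER))
        ≡⟨ cong #distinct (trans (cutLabels-++ V (EL ++ ER)) (cong (cutLabels V ++_) (cutLabels-++ EL ER))) ⟩
      #distinct (cutLabels V ++ cutLabels EL ++ cutLabels ER)
        ≡⟨ #distinct-++ (<-≤-disjoint V<n+1 n+1≤LR) ⟩
      #distinct (cutLabels V) + #distinct (cutLabels EL ++ cutLabels ER)
        ≡⟨ cong (#distinct (cutLabels V) +_) (#distinct-++ (<-≤-disjoint L<m m≤R)) ⟩
      #distinct (cutLabels V) + (#distinct (cutLabels EL) + #distinct (cutLabels ER))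
        ≡⟨ cong₂ _+_ (#distinct-cutLabels-vertexEdges n l r)
                     (cong₂ _+_ (#distinct-cutLabels-tree (suc n) l)
                                (#distinct-cutLabels-tree (treeNext (suc n) l) r)) ⟩
      d1Vertex l r + (d1Tree B l + d1Tree B r)
        ≡⟨ sym (+-assoc (d1Vertex l r) (d1Tree B l) (d1Tree B r)) ⟩
      d1Tree B (node l r) ∎
      where
        open ≡-Reasoning
        V  = vertexEdges n l r
        EL = treeEdgeList (suc n) l
        ER = treeEdgeList (treeNext (suc n) l) r
        V<n+1 : All (_< suc n) (cutLabels V)
        V<n+1 = cutLabels-All (All.map (λ { refl → ≤-refl }) (vertexEdges-labels n l r))
        n+1≤LR : All (suc n ≤_) (cutLabels EL ++ cutLabels ER)
        n+1≤LR = All.++⁺ (cutLabels-All (All.map proj₁ inL)) (cutLabels-All (All.map (≤-trans n<m ∘ proj₁) inR))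
        L<m : All (_< treeNext (suc n) l) (cutLabels EL)
        L<m = cutLabels-All (All.map proj₂ inL)
        m≤R : All (treeNext (suc n) l ≤_) (cutLabels ER)
        m≤R = cutLabels-All (All.map proj₁ inR)

    #distinct-cutLabels-forest : ∀ n F → #distinct (cutLabels (forestEdgeList n F)) ≡ d1 F B
    #distinct-cutLabels-forest n []      = refl
    #distinct-cutLabels-forest n (t ∷ F) = begin
      #distinct (cutLabels (ET ++ EF))          ≡⟨ cong #distinct (cutLabels-++ ET EF) ⟩
      #distinct (cutLabels ET ++ cutLabels EF)  ≡⟨ #distinct-++ (<-≤-disjoint T<m m≤F) ⟩
      #distinct (cutLabels ET) + #distinct (cutLabels EF)
        ≡⟨ cong₂ _+_ (#distinct-cutLabels-tree n t) (#distinct-cutLabels-forest (treeNext n t) F) ⟩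
      d1Tree B t + d1 F B ∎
      where
        open ≡-Reasoning
        ET = treeEdgeList n t
        EF = forestEdgeList (treeNext n t) F
        T<m : All (_< treeNext n t) (cutLabels ET)
        T<m = cutLabels-All (All.map proj₂ (proj₂ (treeEdges-labels n t)))
        m≤F : All (treeNext n t ≤_) (cutLabels EF)
        m≤F = cutLabels-All (forestEdges-labels (treeNext n t) F)

lemma1 : (k : ℕ) (F : Forest k) (B : Side {k}) → IsBipartition F B →
           d1 F B ≡ labelSize (cut F B)
lemma1 k F B _ = sym (#distinct-cutLabels-forest B 1 F)
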